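{- For every $\varepsilon>0$ there exist infinitely many connected edge-weighted graphs $G$ (with weights in $\mathbb{R}_+$), each with a spanning tree $T$, such that $\mathrm{mac}(G)<\frac{w(G)}{2}+\varepsilon\, w(T)$.
   Context: $\mathbb{R}_+$ denotes the non-negative reals; for a subgraph $H$, $w(H)=\sum_{e\in E(H)}w(e)$. $\mathrm{mac}(G)$ is the maximum total weight of the edges between $A$ and $B$ over all partitions $(A,B)$ of $V(G)$.
   Formalization: The parameter ε ranges only over the positive rationals, and the edge weights of the graphs constructed are taken in the non-negative rationals instead of $\mathbb{R}_+$. -}

module Defs where

open import Data.Nat using (ℕ; zero; suc; _∸_) renaming (_<_ to _<ℕ_; _≤_ to _≤ℕ_)
open import Data.Nat.Properties using () renaming (_<?_ to _<ℕ?_)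
open import Data.Bool using (Bool; true; false; if_then_else_; _xor_)
open import Data.Fin using (Fin; toℕ)
open import Data.List using (List; []; _∷_; map; concatMap; filter; foldr; length; allFin; _++_)
open import Data.List.Relation.Unary.Unique.Propositional using (Unique)
open import Data.Vec using (Vec; lookup) renaming ([] to []ᵛ; _∷_ to _∷ᵛ_)
open import Data.Rational using (ℚ; 0ℚ; _+_; _⊔_; _≤_)
open import Data.Unit using (⊤)
open import Data.Empty using (⊥)
open import Data.Product using (_×_; _,_; proj₁; proj₂)
open import Relation.Binary.PropositionalEquality using (_≡_)

Σℚ : List ℚ → ℚ
Σℚ = foldr _+_ 0ℚ

-- Maximum of a list of rationals (0 for the empty list; all uses below are
-- over non-empty lists of non-negative numbers).
maxℚ : List ℚ → ℚ
maxℚ = foldr _⊔_ 0ℚ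

-- Unordered pairs {i,j} of vertices, listed once each as (i , j) with i < j.
pairs : (n : ℕ) → List (Fin n × Fin n)
pairs n = concatMap (λ i → map (λ j → (i , j))
                              (filter (λ j → toℕ i <ℕ? toℕ j) (allFin n)))
                    (allFin n)

record WGraph (n : ℕ) : Set where
  field
    adj     : Fin n → Fin n → Bool
    w       : Fin n → Fin n → ℚ
    adj-sym : ∀ i j → adj i j ≡ adj j i
    adj-irr : ∀ i → adj i i ≡ false
    w-sym   : ∀ i j → w i j ≡ w j i
    w-nonneg : ∀ i j → 0ℚ ≤ w i j
open WGraph public

weightOf : ∀ {n} → WGraph n → (Fin n → Fin n → Bool) → ℚ
weightOf {n} G E = Σℚ (map (λ p → if E (proj₁ p) (proj₂ p) then w G (proj₁ p) (proj₂ p) else 0ℚ) (pairs n))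

wG : ∀ {n} → WGraph n → ℚ
wG G = weightOf G (adj G)

-- Partitions (A,B) of V(G): A is given by a characteristic vector, B its complement.
allSubsets : (n : ℕ) → List (Vec Bool n)
allSubsets zero = []ᵛ ∷ []
allSubsets (suc n) = concatMap (λ A → (true ∷ᵛ A) ∷ (false ∷ᵛ A) ∷ []) (allSubsets n)

cutWeight : ∀ {n} → WGraph n → Vec Bool n → ℚ
cutWeight G A = weightOf G (λ i j → if adj G i j then lookup A i xor lookup A j else false)

mac : ∀ {n} → WGraph n → ℚ
mac {n} G = maxℚ (map (cutWeight G) (allSubsets n))

data Reach {n : ℕ} (E : Fin n → Fin n → Bool) : Fin n → Fin n → Set where
  here : ∀ {u} → Reach E u u
  step : ∀ {u v x} → E u v ≡ true → Reach E v x → Reach E u x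

Connected : ∀ {n} → (Fin n → Fin n → Bool) → Set
Connected {n} E = ∀ (u v : Fin n) → Reach E u v

WalkList : ∀ {n} → (Fin n → Fin n → Bool) → List (Fin n) → Set
WalkList E [] = ⊤
WalkList E (x ∷ []) = ⊤
WalkList E (x ∷ y ∷ xs) = (E x y ≡ true) × WalkList E (y ∷ xs)

record Cycle {n : ℕ} (E : Fin n → Fin n → Bool) : Set where
  field
    first : Fin n
    rest  : List (Fin n)
    long  : 2 ≤ℕ length rest
    distinct : Unique (first ∷ rest)
    walk  : WalkList E (first ∷ rest ++ first ∷ [])

Acyclic : ∀ {n} → (Fin n → Fin n → Bool) → Set
Acyclic E = Cycle E → ⊥

record SpanningTree {n : ℕ} (G : WGraph n) : Set where
  field
    tadj     : Fin n → Fin n → Bool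
    tadj-sym : ∀ i j → tadj i j ≡ tadj j i
    sub      : ∀ i j → tadj i j ≡ true → adj G i j ≡ true
    connected : Connected tadj
    acyclic  : Acyclic tadj
open SpanningTree public

wT : ∀ {n} {G : WGraph n} → SpanningTree G → ℚ
wT {G = G} T = weightOf G (tadj T)

-- On the complete graph with weights w(ij) = xᵢxⱼ, give each vertex the
-- sign sᵢ = ±1 of its side of a cut and put yᵢ = sᵢxᵢ.  An edge ij is cut
-- exactly when yᵢyⱼ = −xᵢxⱼ, so  2·cut + Σ_{i<j} yᵢyⱼ = w(G), and
-- 2·Σ_{i<j} yᵢyⱼ = (Σ yᵢ)² − Σ xᵢ² ≥ −Σ xᵢ².  Hence every cut, and so
-- mac(G), is at most w(G)/2 + (Σ xᵢ²)/4.  For x = (D, 1, …, 1) with K ones,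
-- the star at the first vertex is a spanning tree of weight DK, while
-- Σ xᵢ² = D² + K; choosing D ≥ 1/ε and K ≥ D² gives (D² + K)/4 ≤ K/2 < εDK.
module Submission where

open import Defs
open import Data.Nat using (ℕ) renaming (_<_ to _<ℕ_)
open import Data.Rational using (ℚ; 0ℚ; _<_; _+_; _*_; ½)
open import Data.Product using (Σ; _×_)

open import Algebra.Bundles using (Ring)
open import Data.Bool using (Bool; true; false; if_then_else_; _xor_)
open import Data.Empty using (⊥)
open import Data.Fin using (Fin; toℕ; zero; suc)
open import Data.Vec using (Vec; lookup)
import Data.Integer as ℤ
import Data.Integer.Properties as ℤ
open import Data.List using (List; []; _∷_; map; _++_; filter; concat; concatMap; allFin; length)
open import Data.List.Properties
  using (map-tabulate; map-∘; map-cong; map-++; concatMap-map; concatMap-cong; concat-map; filter-all)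
open import Data.List.Relation.Unary.All using (universal; _∷_)
open import Data.List.Relation.Unary.AllPairs using (_∷_)
open import Data.List.Relation.Unary.Unique.Propositional using (Unique)
open import Data.Nat using (zero; suc; s≤s; z≤n) renaming (_≤_ to _≤ℕ_; _+_ to _+ℕ_; _*_ to _*ℕ_)
import Data.Nat.Properties as ℕ
open import Data.Nat.Properties using () renaming (_<?_ to _<ℕ?_)
open import Data.Product using (_,_; proj₁; proj₂; ∃)
import Data.Product as Prod
open import Data.Rational using (1ℚ; -_; _≤_; _/_; 1/_; NonZero; positive; nonNegative; nonPositive; mkℚ; toℚᵘ)
open import Data.Rational.Properties
import Data.Rational.Unnormalised as ℚᵘ
import Data.Rational.Unnormalised.Properties as ℚᵘ
open import Data.Rational.Solver using (module +-*-Solver)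
open +-*-Solver
open import Data.Sum using (inj₁; inj₂)
open import Data.Unit using (tt)
open import Function using (_∘_; id)
open import Relation.Binary.PropositionalEquality
open import Relation.Nullary using (does)
open import Relation.Nullary.Decidable using (toWitness)
open import Relation.Unary using (Pred; Decidable)
open import Relation.Unary.Properties using (U?)

open import Algebra.Properties.Semiring.Mult (Ring.semiring +-*-ring)
  using (×-comm-*) renaming (_×_ to _×ℚ_)

filter-map : ∀ {a b p q} {A : Set a} {B : Set b} {P : Pred B p} {Q : Pred A q}
             (P? : Decidable P) (Q? : Decidable Q) (f : A → B) →
             (∀ x → does (P? (f x)) ≡ does (Q? x)) →
             ∀ xs → filter P? (map f xs) ≡ map f (filter Q? xs)
filter-map P? Q? f agree [] = refl
filter-map P? Q? f agree (x ∷ xs) rewrite agree x with does (Q? x)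
... | true  = cong (f x ∷_) (filter-map P? Q? f agree xs)
... | false = filter-map P? Q? f agree xs

allFin-suc : ∀ n → allFin (suc n) ≡ zero ∷ map suc (allFin n)
allFin-suc n = cong (zero ∷_) (sym (map-tabulate id suc))

row : ∀ n → Fin n → List (Fin n × Fin n)
row n i = map (i ,_) (filter (λ j → toℕ i <ℕ? toℕ j) (allFin n))

-- The tests 0 < 1+j and 1+i < 1+j compute to true and i < j, hence the refls.
row-zero : ∀ n → row (suc n) zero ≡ map (λ j → (zero , suc j)) (allFin n)
row-zero n = begin
  map (zero ,_) (filter (λ j → 0 <ℕ? toℕ j) (allFin (suc n)))
    ≡⟨ cong (λ js → map (zero ,_) (filter (λ j → 0 <ℕ? toℕ j) js)) (allFin-suc n) ⟩
  map (zero ,_) (filter (λ j → 0 <ℕ? toℕ j) (map suc (allFin n)))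
    ≡⟨ cong (map (zero ,_)) (filter-map _ U? suc (λ _ → refl) (allFin n)) ⟩
  map (zero ,_) (map suc (filter U? (allFin n)))
    ≡⟨ cong (map (zero ,_) ∘ map suc) (filter-all U? (universal _ (allFin n))) ⟩
  map (zero ,_) (map suc (allFin n))
    ≡⟨ map-∘ (allFin n) ⟨
  map (λ j → (zero , suc j)) (allFin n) ∎
  where open ≡-Reasoning

row-suc : ∀ n i → row (suc n) (suc i) ≡ map (Prod.map suc suc) (row n i)
row-suc n i = begin
  map (suc i ,_) (filter (λ j → suc (toℕ i) <ℕ? toℕ j) (allFin (suc n)))
    ≡⟨ cong (λ js → map (suc i ,_) (filter (λ j → suc (toℕ i) <ℕ? toℕ j) js)) (allFin-suc n) ⟩
  map (suc i ,_) (filter (λ j → suc (toℕ i) <ℕ? toℕ j) (map suc (allFin n)))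
    ≡⟨ cong (map (suc i ,_)) (filter-map _ _ suc (λ _ → refl) (allFin n)) ⟩
  map (suc i ,_) (map suc (filter (λ j → toℕ i <ℕ? toℕ j) (allFin n)))
    ≡⟨ map-∘ _ ⟨
  map (λ j → (suc i , suc j)) (filter (λ j → toℕ i <ℕ? toℕ j) (allFin n))
    ≡⟨ map-∘ _ ⟩
  map (Prod.map suc suc) (row n i) ∎
  where open ≡-Reasoning

pairs-suc : ∀ n → pairs (suc n) ≡
            map (λ j → (zero , suc j)) (allFin n) ++ map (Prod.map suc suc) (pairs n)
pairs-suc n = trans (cong (concatMap (row (suc n))) (allFin-suc n))
                    (cong₂ _++_ (row-zero n) shifted)
  where
  open ≡-Reasoning
  shifted : concatMap (row (suc n)) (map suc (allFin n)) ≡ map (Prod.map suc suc) (pairs n)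
  shifted = begin
    concatMap (row (suc n)) (map suc (allFin n))
      ≡⟨ concatMap-map (row (suc n)) suc (allFin n) ⟩
    concatMap (row (suc n) ∘ suc) (allFin n)
      ≡⟨ concatMap-cong (row-suc n) (allFin n) ⟩
    concat (map (map (Prod.map suc suc) ∘ row n) (allFin n))
      ≡⟨ cong concat (map-∘ (allFin n)) ⟩
    concat (map (map (Prod.map suc suc)) (map (row n) (allFin n)))
      ≡⟨ concat-map (map (row n) (allFin n)) ⟩
    map (Prod.map suc suc) (pairs n) ∎

Σℚ-++ : ∀ xs ys → Σℚ (xs ++ ys) ≡ Σℚ xs + Σℚ ys
Σℚ-++ []       ys = sym (+-identityˡ _)
Σℚ-++ (x ∷ xs) ys = trans (cong (x +_) (Σℚ-++ xs ys)) (sym (+-assoc x _ _))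

module _ {a} {A : Set a} where

  Σℚ-map-+ : ∀ (f g : A → ℚ) xs →
             Σℚ (map (λ x → f x + g x) xs) ≡ Σℚ (map f xs) + Σℚ (map g xs)
  Σℚ-map-+ f g []       = refl
  Σℚ-map-+ f g (x ∷ xs) = trans (cong (f x + g x +_) (Σℚ-map-+ f g xs))
    (solve 4 (λ a b c d → (a :+ b) :+ (c :+ d) := (a :+ c) :+ (b :+ d)) refl
             (f x) (g x) (Σℚ (map f xs)) (Σℚ (map g xs)))

  Σℚ-map-* : ∀ c (f : A → ℚ) xs → Σℚ (map (λ x → c * f x) xs) ≡ c * Σℚ (map f xs)
  Σℚ-map-* c f []       = sym (*-zeroʳ c)
  Σℚ-map-* c f (x ∷ xs) =
    trans (cong (c * f x +_) (Σℚ-map-* c f xs)) (sym (*-distribˡ-+ c (f x) _))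

  Σℚ-map-0 : ∀ (xs : List A) → Σℚ (map (λ _ → 0ℚ) xs) ≡ 0ℚ
  Σℚ-map-0 []       = refl
  Σℚ-map-0 (x ∷ xs) = trans (+-identityˡ _) (Σℚ-map-0 xs)

  Σℚ-map-nonNeg : ∀ (f : A → ℚ) → (∀ x → 0ℚ ≤ f x) → ∀ xs → 0ℚ ≤ Σℚ (map f xs)
  Σℚ-map-nonNeg f f≥0 []       = ≤-refl
  Σℚ-map-nonNeg f f≥0 (x ∷ xs) = +-mono-≤ (f≥0 x) (Σℚ-map-nonNeg f f≥0 xs)

sumFin : ∀ {n} → (Fin n → ℚ) → ℚ
sumFin {n} y = Σℚ (map y (allFin n))

sumFin-suc : ∀ {n} (f : Fin (suc n) → ℚ) → sumFin f ≡ f zero + sumFin (f ∘ suc)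
sumFin-suc {n} f =
  cong Σℚ (trans (cong (map f) (allFin-suc n)) (cong (f zero ∷_) (sym (map-∘ (allFin n)))))

Σℚ-pairs-suc : ∀ n (f : Fin (suc n) × Fin (suc n) → ℚ) →
               Σℚ (map f (pairs (suc n))) ≡
               Σℚ (map (λ j → f (zero , suc j)) (allFin n)) + Σℚ (map (f ∘ Prod.map suc suc) (pairs n))
Σℚ-pairs-suc n f = begin
  Σℚ (map f (pairs (suc n)))
    ≡⟨ cong (Σℚ ∘ map f) (pairs-suc n) ⟩
  Σℚ (map f (spokes ++ shifted))
    ≡⟨ cong Σℚ (map-++ f spokes shifted) ⟩
  Σℚ (map f spokes ++ map f shifted)
    ≡⟨ Σℚ-++ (map f spokes) (map f shifted) ⟩
  Σℚ (map f spokes) + Σℚ (map f shifted)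
    ≡⟨ cong₂ (λ xs ys → Σℚ xs + Σℚ ys) (map-∘ (allFin n)) (map-∘ (pairs n)) ⟨
  Σℚ (map (λ j → f (zero , suc j)) (allFin n)) + Σℚ (map (f ∘ Prod.map suc suc) (pairs n)) ∎
  where
  open ≡-Reasoning
  spokes shifted : List (Fin (suc n) × Fin (suc n))
  spokes  = map (λ j → (zero , suc j)) (allFin n)
  shifted = map (Prod.map suc suc) (pairs n)

sumFin-const : ∀ n c → sumFin {n} (λ _ → c) ≡ n ×ℚ c
sumFin-const zero    c = refl
sumFin-const (suc n) c = trans (sumFin-suc {n} (λ _ → c)) (cong (c +_) (sumFin-const n c))

*-nonNeg : ∀ {p q} → 0ℚ ≤ p → 0ℚ ≤ q → 0ℚ ≤ p * q
*-nonNeg {p} {q} p≥0 q≥0 =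
  nonNegative⁻¹ (p * q) {{nonNeg*nonNeg⇒nonNeg p {{nonNegative p≥0}} q {{nonNegative q≥0}}}}

square-nonNeg : ∀ p → 0ℚ ≤ p * p
square-nonNeg p with ≤-total 0ℚ p
... | inj₁ p≥0 = *-nonNeg p≥0 p≥0
... | inj₂ p≤0 = nonNegative⁻¹ (p * p) {{nonPos*nonPos⇒nonPos p {{nonPositive p≤0}} p {{nonPositive p≤0}}}}

complete : ∀ {n} → Fin n → Fin n → Bool
complete zero    zero    = false
complete zero    (suc _) = true
complete (suc _) zero    = true
complete (suc i) (suc j) = complete i j

complete-sym : ∀ {n} (i j : Fin n) → complete i j ≡ complete j i
complete-sym zero    zero    = refl
complete-sym zero    (suc j) = refl
complete-sym (suc i) zero    = refl
complete-sym (suc i) (suc j) = complete-sym i j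

complete-irrefl : ∀ {n} (i : Fin n) → complete i i ≡ false
complete-irrefl zero    = refl
complete-irrefl (suc i) = complete-irrefl i

productGraph : ∀ {n} (x : Fin n → ℚ) → (∀ i → 0ℚ ≤ x i) → WGraph n
productGraph x x≥0 = record
  { adj      = complete
  ; w        = λ i j → x i * x j
  ; adj-sym  = complete-sym
  ; adj-irr  = complete-irrefl
  ; w-sym    = λ i j → *-comm (x i) (x j)
  ; w-nonneg = λ i j → *-nonNeg (x≥0 i) (x≥0 j)
  }

-- The guard is true on every listed pair i < j; it makes the summands match
-- those of wG and cutWeight of a product graph term by term.
crossSum : ∀ {n} → (Fin n → ℚ) → ℚ
crossSum {n} y = Σℚ (map (λ (i , j) → if complete i j then y i * y j else 0ℚ) (pairs n))

crossSum-suc : ∀ {n} (y : Fin (suc n) → ℚ) →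
               crossSum y ≡ y zero * sumFin (y ∘ suc) + crossSum (y ∘ suc)
crossSum-suc {n} y = trans (Σℚ-pairs-suc n _)
  (cong (_+ crossSum (y ∘ suc)) (Σℚ-map-* (y zero) (y ∘ suc) (allFin n)))

square-of-sum : ∀ n (y : Fin n → ℚ) →
                sumFin (λ i → y i * y i) + (crossSum y + crossSum y) ≡ sumFin y * sumFin y
square-of-sum zero    y = refl
square-of-sum (suc n) y = begin
  sumFin (λ i → y i * y i) + (crossSum y + crossSum y)
    ≡⟨ cong₂ (λ u v → u + (v + v)) (sumFin-suc (λ i → y i * y i)) (crossSum-suc y) ⟩
  (a * a + q) + ((a * s + p) + (a * s + p))
    ≡⟨ solve 4 (λ a s q p → (a :* a :+ q) :+ ((a :* s :+ p) :+ (a :* s :+ p))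
                         := a :* a :+ a :* s :+ a :* s :+ (q :+ (p :+ p))) refl a s q p ⟩
  a * a + a * s + a * s + (q + (p + p))
    ≡⟨ cong (a * a + a * s + a * s +_) (square-of-sum n (y ∘ suc)) ⟩
  a * a + a * s + a * s + s * s
    ≡⟨ solve 2 (λ a s → a :* a :+ a :* s :+ a :* s :+ s :* s := (a :+ s) :* (a :+ s)) refl a s ⟩
  (a + s) * (a + s)
    ≡⟨ cong (λ t → t * t) (sumFin-suc y) ⟨
  sumFin y * sumFin y ∎
  where
  open ≡-Reasoning
  a s q p : ℚ
  a = y zero
  s = sumFin (y ∘ suc)
  q = sumFin (λ i → y (suc i) * y (suc i))
  p = crossSum (y ∘ suc)

¼ : ℚ
¼ = ℤ.+ 1 / 4

0≤¼ : 0ℚ ≤ ¼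
0≤¼ = toWitness {a? = 0ℚ ≤? ¼} tt

sign : Bool → ℚ
sign true  = 1ℚ
sign false = - 1ℚ

module _ {n} (x : Fin n → ℚ) (x≥0 : ∀ i → 0ℚ ≤ x i) (A : Vec Bool n) where

  private
    G : WGraph n
    G = productGraph x x≥0

    y : Fin n → ℚ
    y i = sign (lookup A i) * x i

    cutTerm wTerm crossTerm : Fin n × Fin n → ℚ
    cutTerm (i , j) = if (if complete i j then lookup A i xor lookup A j else false) then x i * x j else 0ℚ
    wTerm (i , j) = if complete i j then x i * x j else 0ℚ
    crossTerm (i , j) = if complete i j then y i * y j else 0ℚ

    twice-cut+cross-pair : ∀ p → (cutTerm p + cutTerm p) + crossTerm p ≡ wTerm p
    twice-cut+cross-pair (i , j) with complete i j
    ... | false = refl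
    ... | true with lookup A i | lookup A j
    ... | true  | true  = solve 2 (λ a b → (con 0ℚ :+ con 0ℚ) :+ (con 1ℚ :* a) :* (con 1ℚ :* b)
                                         := a :* b) refl (x i) (x j)
    ... | true  | false = solve 2 (λ a b → (a :* b :+ a :* b) :+ (con 1ℚ :* a) :* (con (- 1ℚ) :* b)
                                         := a :* b) refl (x i) (x j)
    ... | false | true  = solve 2 (λ a b → (a :* b :+ a :* b) :+ (con (- 1ℚ) :* a) :* (con 1ℚ :* b)
                                         := a :* b) refl (x i) (x j)
    ... | false | false = solve 2 (λ a b → (con 0ℚ :+ con 0ℚ) :+ (con (- 1ℚ) :* a) :* (con (- 1ℚ) :* b)
                                         := a :* b) refl (x i) (x j)

    signed-square : ∀ i → y i * y i ≡ x i * x i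
    signed-square i with lookup A i
    ... | true  = solve 1 (λ a → (con 1ℚ :* a) :* (con 1ℚ :* a) := a :* a) refl (x i)
    ... | false = solve 1 (λ a → (con (- 1ℚ) :* a) :* (con (- 1ℚ) :* a) := a :* a) refl (x i)

    twice-cut+cross : cutWeight G A + cutWeight G A + crossSum y ≡ wG G
    twice-cut+cross = begin
      cutWeight G A + cutWeight G A + crossSum y
        ≡⟨ cong (_+ crossSum y) (Σℚ-map-+ cutTerm cutTerm (pairs n)) ⟨
      Σℚ (map (λ p → cutTerm p + cutTerm p) (pairs n)) + crossSum y
        ≡⟨ Σℚ-map-+ (λ p → cutTerm p + cutTerm p) crossTerm (pairs n) ⟨
      Σℚ (map (λ p → (cutTerm p + cutTerm p) + crossTerm p) (pairs n))
        ≡⟨ cong Σℚ (map-cong twice-cut+cross-pair (pairs n)) ⟩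
      wG G ∎
      where open ≡-Reasoning

  cutWeight-productGraph-≤ : cutWeight G A ≤ ½ * wG G + ¼ * sumFin (λ i → x i * x i)
  cutWeight-productGraph-≤ = begin
    C                        ≡⟨ +-identityʳ C ⟨
    C + 0ℚ                   ≤⟨ +-monoʳ-≤ C (*-nonNeg 0≤¼ (square-nonNeg S)) ⟩
    C + ¼ * (S * S)          ≡⟨ cong (λ t → C + ¼ * t) (square-of-sum n y) ⟨
    C + ¼ * (Y + (P + P))    ≡⟨ solve 3 (λ C P Y → C :+ con ¼ :* (Y :+ (P :+ P))
                                                := con ½ :* ((C :+ C) :+ P) :+ con ¼ :* Y) refl C P Y ⟩
    ½ * (C + C + P) + ¼ * Y  ≡⟨ cong₂ (λ u v → ½ * u + ¼ * v)
                                      twice-cut+cross (cong Σℚ (map-cong signed-square (allFin n))) ⟩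
    ½ * wG G + ¼ * sumFin (λ i → x i * x i) ∎
    where
    open ≤-Reasoning
    C S P Y : ℚ
    C = cutWeight G A
    S = sumFin y
    P = crossSum y
    Y = sumFin (λ i → y i * y i)

maxℚ-lub : ∀ {a} {A : Set a} (f : A → ℚ) {b} → 0ℚ ≤ b → (∀ x → f x ≤ b) → ∀ xs → maxℚ (map f xs) ≤ b
maxℚ-lub f b≥0 f≤b []       = b≥0
maxℚ-lub f b≥0 f≤b (x ∷ xs) = ⊔-lub (f≤b x) (maxℚ-lub f b≥0 f≤b xs)

weightOf-nonNeg : ∀ {n} (G : WGraph n) E → 0ℚ ≤ weightOf G E
weightOf-nonNeg {n} G E = Σℚ-map-nonNeg _ (λ (i , j) → term≥0 i j) (pairs n)
  where
  term≥0 : ∀ i j → 0ℚ ≤ (if E i j then w G i j else 0ℚ)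
  term≥0 i j with E i j
  ... | true  = w-nonneg G i j
  ... | false = ≤-refl

mac-productGraph-≤ : ∀ {n} (x : Fin n → ℚ) (x≥0 : ∀ i → 0ℚ ≤ x i) →
                     mac (productGraph x x≥0) ≤ ½ * wG (productGraph x x≥0) + ¼ * sumFin (λ i → x i * x i)
mac-productGraph-≤ {n} x x≥0 =
  maxℚ-lub (cutWeight G) bound≥0 (cutWeight-productGraph-≤ x x≥0) (allSubsets n)
  where
  G : WGraph n
  G = productGraph x x≥0
  bound≥0 : 0ℚ ≤ ½ * wG G + ¼ * sumFin (λ i → x i * x i)
  bound≥0 = +-mono-≤
    (*-nonNeg (toWitness {a? = 0ℚ ≤? ½} tt) (weightOf-nonNeg G (adj G)))
    (*-nonNeg 0≤¼ (Σℚ-map-nonNeg _ (λ i → *-nonNeg (x≥0 i) (x≥0 i)) (allFin n)))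

star : ∀ {n} → Fin (suc n) → Fin (suc n) → Bool
star zero    zero    = false
star zero    (suc _) = true
star (suc _) zero    = true
star (suc _) (suc _) = false

star-sym : ∀ {n} (i j : Fin (suc n)) → star i j ≡ star j i
star-sym zero    zero    = refl
star-sym zero    (suc j) = refl
star-sym (suc i) zero    = refl
star-sym (suc i) (suc j) = refl

Reach-trans : ∀ {n} {E : Fin n → Fin n → Bool} {u v x} → Reach E u v → Reach E v x → Reach E u x
Reach-trans here         r′ = r′
Reach-trans (step e r) r′ = step e (Reach-trans r r′)

hub⇒connected : ∀ {n} (E : Fin (suc n) → Fin (suc n) → Bool) →
                (∀ j → E zero (suc j) ≡ true) → (∀ j → E (suc j) zero ≡ true) → Connected E
hub⇒connected E out in′ u v = Reach-trans (toHub u) (fromHub v)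
  where
  toHub : ∀ u → Reach E u zero
  toHub zero    = here
  toHub (suc j) = step (in′ j) here
  fromHub : ∀ v → Reach E zero v
  fromHub zero    = here
  fromHub (suc j) = step (out j) here

-- a closed walk of length ≥ 3 in a star visits the hub twice, or some leaf twice
star-acyclic : ∀ {n} → Acyclic (star {n})
star-acyclic c = noCycle (Cycle.first c) (Cycle.rest c) (Cycle.long c) (Cycle.distinct c) (Cycle.walk c)
  where
  noCycle : ∀ {n} (v : Fin (suc n)) vs → 2 ≤ℕ length vs →
            Unique (v ∷ vs) → WalkList star (v ∷ vs ++ v ∷ []) → ⊥
  noCycle v []      () _ _
  noCycle v (_ ∷ []) (s≤s ()) _ _
  noCycle zero    (zero ∷ _ ∷ _)               _ _                       (() , _)
  noCycle zero    (suc a ∷ zero ∷ _)           _ ((_ ∷ 0≢0 ∷ _) ∷ _)     _ = 0≢0 refl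
  noCycle zero    (suc a ∷ suc b ∷ _)          _ _                       (_ , () , _)
  noCycle (suc c) (suc a ∷ _ ∷ _)              _ _                       (() , _)
  noCycle (suc c) (zero ∷ zero ∷ _)            _ _                       (_ , () , _)
  noCycle (suc c) (zero ∷ suc b ∷ [])          _ _                       (_ , _ , () , _)
  noCycle (suc c) (zero ∷ suc b ∷ zero ∷ _)    _ (_ ∷ (_ ∷ 0≢0 ∷ _) ∷ _) _ = 0≢0 refl
  noCycle (suc c) (zero ∷ suc b ∷ suc d ∷ _)   _ _                       (_ , _ , () , _)

starTree : ∀ {n} (G : WGraph (suc n)) → (∀ j → adj G zero (suc j) ≡ true) → SpanningTree G
starTree G hub = record
  { tadj      = star
  ; tadj-sym  = star-sym
  ; sub       = star⊆G
  ; connected = hub⇒connected star (λ _ → refl) (λ _ → refl)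
  ; acyclic   = star-acyclic
  }
  where
  star⊆G : ∀ i j → star i j ≡ true → adj G i j ≡ true
  star⊆G zero    (suc j) _ = hub j
  star⊆G (suc i) zero    _ = trans (adj-sym G (suc i) zero) (hub i)

wT-starTree : ∀ {n} (G : WGraph (suc n)) (hub : ∀ j → adj G zero (suc j) ≡ true) →
              wT (starTree G hub) ≡ sumFin (λ j → w G zero (suc j))
wT-starTree {n} G hub = begin
  wT (starTree G hub)
    ≡⟨ Σℚ-pairs-suc n _ ⟩
  sumFin (λ j → w G zero (suc j)) + Σℚ (map (λ _ → 0ℚ) (pairs n))
    ≡⟨ cong (sumFin (λ j → w G zero (suc j)) +_) (Σℚ-map-0 (pairs n)) ⟩
  sumFin (λ j → w G zero (suc j)) + 0ℚ
    ≡⟨ +-identityʳ _ ⟩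
  sumFin (λ j → w G zero (suc j)) ∎
  where open ≡-Reasoning

0≤1 : 0ℚ ≤ 1ℚ
0≤1 = toWitness {a? = 0ℚ ≤? 1ℚ} tt

×1-nonNeg : ∀ m → 0ℚ ≤ m ×ℚ 1ℚ
×1-nonNeg zero    = ≤-refl
×1-nonNeg (suc m) = +-mono-≤ 0≤1 (×1-nonNeg m)

×1-mono-≤ : ∀ {m n} → m ≤ℕ n → m ×ℚ 1ℚ ≤ n ×ℚ 1ℚ
×1-mono-≤ {n = n} z≤n = ×1-nonNeg n
×1-mono-≤ (s≤s m≤n)   = +-monoʳ-≤ 1ℚ (×1-mono-≤ m≤n)

toℚᵘ-×1 : ∀ m → toℚᵘ (m ×ℚ 1ℚ) ℚᵘ.≃ ℚᵘ.mkℚᵘ (ℤ.+ m) 0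
toℚᵘ-×1 zero    = ℚᵘ.≃-refl
toℚᵘ-×1 (suc m) = ℚᵘ.≃-trans (toℚᵘ-homo-+ 1ℚ (m ×ℚ 1ℚ))
  (ℚᵘ.≃-trans (ℚᵘ.+-congʳ (toℚᵘ 1ℚ) (toℚᵘ-×1 m))
    (ℚᵘ.*≡* (trans (ℤ.*-identityʳ _)
                   (trans (cong (ℤ._+_ (ℤ.+ 1)) (ℤ.*-identityʳ (ℤ.+ m))) (sym (ℤ.*-identityʳ _))))))

-- n/(d+1) ≤ |n|, compared as cross products n·1 ≤ |n|·(d+1)
archimedean : ∀ r → ∃ λ m → r ≤ m ×ℚ 1ℚ
archimedean (mkℚ n d _) =
  ℤ.∣ n ∣ , toℚᵘ-cancel-≤ (ℚᵘ.≤-respʳ-≃ (ℚᵘ.≃-sym (toℚᵘ-×1 ℤ.∣ n ∣)) (ℚᵘ.*≤* (cross n)))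
  where
  cross : ∀ n → n ℤ.* ℤ.+ 1 ℤ.≤ ℤ.+ ℤ.∣ n ∣ ℤ.* ℤ.+ suc d
  cross (ℤ.+ k)    = subst₂ ℤ._≤_ (ℤ.pos-* k 1) (ℤ.pos-* k (suc d)) (ℤ.+≤+ (ℕ.*-monoʳ-≤ k (s≤s z≤n)))
  cross ℤ.-[1+ k ] = subst (ℤ._≤ ℤ.+ suc (d +ℕ k *ℕ suc d)) (sym (ℤ.*-identityʳ ℤ.-[1+ k ])) ℤ.-≤+

hubWeights : ℚ → ∀ {k} → Fin (suc k) → ℚ
hubWeights D zero    = D
hubWeights D (suc _) = 1ℚ

hubWeights-nonNeg : ∀ {D} → 0ℚ ≤ D → ∀ {k} (i : Fin (suc k)) → 0ℚ ≤ hubWeights D i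
hubWeights-nonNeg D≥0 zero    = D≥0
hubWeights-nonNeg D≥0 (suc _) = 0≤1

sumFin-hubWeights-squares : ∀ D k →
  sumFin (λ i → hubWeights D {k} i * hubWeights D i) ≡ D * D + k ×ℚ 1ℚ
sumFin-hubWeights-squares D k =
  trans (sumFin-suc (λ i → hubWeights D {k} i * hubWeights D i)) (cong (D * D +_) (sumFin-const k 1ℚ))

wT-hubWeights-star : ∀ {D} (D≥0 : 0ℚ ≤ D) k →
  wT (starTree (productGraph (hubWeights D {k}) (hubWeights-nonNeg D≥0)) (λ _ → refl)) ≡ D * (k ×ℚ 1ℚ)
wT-hubWeights-star {D} D≥0 k =
  trans (wT-starTree (productGraph (hubWeights D {k}) (hubWeights-nonNeg D≥0)) (λ _ → refl))
  (trans (sumFin-const k (D * 1ℚ)) (sym (×-comm-* k D 1ℚ)))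

¼[D*D+K]<ε[D*K] : ∀ {ε D K} → 1ℚ ≤ ε * D → D * D ≤ K → 0ℚ < K → ¼ * (D * D + K) < ε * (D * K)
¼[D*D+K]<ε[D*K] {ε} {D} {K} 1≤εD D*D≤K K>0 = begin-strict
  ¼ * (D * D + K)  ≤⟨ *-monoˡ-≤-nonNeg ¼ {{nonNegative 0≤¼}} (+-monoˡ-≤ K D*D≤K) ⟩
  ¼ * (K + K)      ≡⟨ solve 1 (λ k → con ¼ :* (k :+ k) := con ½ :* k) refl K ⟩
  ½ * K            <⟨ *-monoˡ-<-pos K {{positive K>0}} (toWitness {a? = ½ <? 1ℚ} tt) ⟩
  1ℚ * K           ≤⟨ *-monoʳ-≤-nonNeg K {{nonNegative (<⇒≤ K>0)}} 1≤εD ⟩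
  ε * D * K        ≡⟨ *-assoc ε D K ⟩
  ε * (D * K)      ∎
  where open ≤-Reasoning

hubStar-mac< : ∀ ε {D} (D≥0 : 0ℚ ≤ D) k → 1ℚ ≤ ε * D → D * D ≤ suc k ×ℚ 1ℚ →
  let G = productGraph (hubWeights D {suc k}) (hubWeights-nonNeg D≥0) in
  mac G < ½ * wG G + ε * wT (starTree G (λ _ → refl))
hubStar-mac< ε {D} D≥0 k 1≤εD D*D≤K =
  ≤-<-trans (mac-productGraph-≤ (hubWeights D {suc k}) (hubWeights-nonNeg D≥0))
    (+-monoʳ-< (½ * wG G) (subst₂ (λ s t → ¼ * s < ε * t)
      (sym (sumFin-hubWeights-squares D (suc k))) (sym (wT-hubWeights-star D≥0 (suc k)))
      (¼[D*D+K]<ε[D*K] {ε} {D} 1≤εD D*D≤K K>0)))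
  where
  G : WGraph (suc (suc k))
  G = productGraph (hubWeights D) (hubWeights-nonNeg D≥0)
  K>0 : 0ℚ < suc k ×ℚ 1ℚ
  K>0 = <-≤-trans (toWitness {a? = 0ℚ <? 1 ×ℚ 1ℚ} tt) (×1-mono-≤ {1} {suc k} (s≤s z≤n))

theorem3p3 : ∀ (ε : ℚ) → 0ℚ < ε → ∀ (N : ℕ) →
    Σ ℕ (λ n → N <ℕ n × Σ (WGraph n) (λ G → Connected (adj G) ×
    Σ (SpanningTree G) (λ T → mac G < ½ * wG G + ε * wT T)))
theorem3p3 ε ε>0 N =
  suc (suc k) , s≤s (ℕ.m≤n⇒m≤1+n (ℕ.m≤m+n N m′)) ,
  G , hub⇒connected complete (λ _ → refl) (λ _ → refl) ,
  starTree G (λ _ → refl) , hubStar-mac< ε D≥0 k 1≤εD D*D≤K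
  where
  instance ε≢0 : NonZero ε
  ε≢0 = pos⇒nonZero ε {{positive ε>0}}
  m m′ k : ℕ
  D : ℚ
  m  = proj₁ (archimedean (1/ ε))
  D  = m ×ℚ 1ℚ
  m′ = proj₁ (archimedean (D * D))
  k  = N +ℕ m′
  D≥0 : 0ℚ ≤ D
  D≥0 = ×1-nonNeg m
  G : WGraph (suc (suc k))
  G = productGraph (hubWeights D) (hubWeights-nonNeg D≥0)
  1≤εD : 1ℚ ≤ ε * D
  1≤εD = subst (_≤ ε * D) (*-inverseʳ ε)
    (*-monoˡ-≤-nonNeg ε {{nonNegative (<⇒≤ ε>0)}} (proj₂ (archimedean (1/ ε))))
  D*D≤K : D * D ≤ suc k ×ℚ 1ℚ
  D*D≤K = ≤-trans (proj₂ (archimedean (D * D))) (×1-mono-≤ {m′} {suc k} (ℕ.m≤n⇒m≤1+n (ℕ.m≤n+m m′ N)))
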